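{- Let $D$ be a finite connected digraph with $\chi(D)=5$, not isomorphic to $T_5$, in which every vertex has out-degree at least $2$, such that $D$ contains no copy of $p_4$ and the underlying graph of $D$ contains no $K_5$. Let $D'$ be a $5$-critical subdigraph of $D$ and let $D^o$ be the set of vertices whose out-degree in $D'$ is at least $3$. Then every $v\in D^o$ has exactly three out-neighbors $v_1,v_2,v_3$ in $D'$, and they can be labeled so that $v_1\to v_2$ and $v_1\to v_3$.
   Context: A digraph has no loops and, for any two vertices $x,y$, at most one of the arcs $(x,y),(y,x)$; $\chi$ is the chromatic number of the underlying (unoriented) graph. $T_5$ is the $5$-vertex tournament in which every vertex has in- and out-degree $2$. $p_4$ is the digraph with vertices $x,y,z,v,w$ and arcs $y\to x$, $y\to z$, $v\to z$, $v\to w$; a copy of $H$ in $D$ is the image of an injective arc-preserving map $V(H)\to V(D)$. A subdigraph $D'$ is $5$-critical if $\chi(D')=5$ and $\chi(D'-u)<5$ for every vertex $u$ of $D'$. -}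

module Defs where

open import Data.Nat using (ℕ; zero; suc; _<_; _≤_)
open import Data.Fin using (Fin; zero; suc)
open import Data.Bool using (Bool; true; false; T; _∧_)
open import Data.List using (List; length; filterᵇ; allFin)
open import Data.Product using (Σ; ∃; _×_; _,_)
open import Data.Sum using (_⊎_)
open import Data.Empty using (⊥)
open import Relation.Nullary using (¬_)
open import Relation.Binary.PropositionalEquality using (_≡_; _≢_)
open import Function.Definitions using (Injective)
open import Function.Bundles using (_⤖_; Func; Bijection)

record Digraph : Set where
  field
    n        : ℕ
    arc      : Fin n → Fin n → Bool
    loopless : ∀ x → arc x x ≡ false
    asym     : ∀ x y → arc x y ≡ true → arc y x ≡ false

open Digraph public

_⟶[_]_ : {m : ℕ} → Fin m → (Fin m → Fin m → Bool) → Fin m → Set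
x ⟶[ a ] y = a x y ≡ true

Adj : {m : ℕ} → (Fin m → Fin m → Bool) → Fin m → Fin m → Set
Adj a x y = (a x y ≡ true) ⊎ (a y x ≡ true)

outdeg : {m : ℕ} → (Fin m → Fin m → Bool) → Fin m → ℕ
outdeg a v = length (filterᵇ (a v) (allFin _))

data Reach {m : ℕ} (a : Fin m → Fin m → Bool) (x : Fin m) : Fin m → Set where
  here : Reach a x x
  step : ∀ {y z} → Reach a x y → Adj a y z → Reach a x z

Connected : Digraph → Set
Connected D = ∀ x y → Reach (arc D) x y

ProperColouring : {m : ℕ} → (S : Fin m → Bool) → (Fin m → Fin m → Bool) → (k : ℕ) → (Fin m → Fin k) → Set
ProperColouring S a k c = ∀ x y → S x ≡ true → S y ≡ true → Adj a x y → c x ≢ c y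

Colourable : {m : ℕ} → (S : Fin m → Bool) → (Fin m → Fin m → Bool) → ℕ → Set
Colourable S a k = Σ (Fin _ → Fin k) (ProperColouring S a k)

ChiEq : {m : ℕ} → (S : Fin m → Bool) → (Fin m → Fin m → Bool) → ℕ → Set
ChiEq S a zero    = Colourable S a zero
ChiEq S a (suc k) = Colourable S a (suc k) × ¬ Colourable S a k

allV : {m : ℕ} → Fin m → Bool
allV _ = true

χ≡ : Digraph → ℕ → Set
χ≡ D k = ChiEq (allV {n D}) (arc D) k

-- The regular tournament T5 on Fin 5: i → i+1, i → i+2 (mod 5)
T5arc : Fin 5 → Fin 5 → Bool
T5arc zero (suc zero) = true
T5arc zero (suc (suc zero)) = true
T5arc (suc zero) (suc (suc zero)) = true
T5arc (suc zero) (suc (suc (suc zero))) = true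
T5arc (suc (suc zero)) (suc (suc (suc zero))) = true
T5arc (suc (suc zero)) (suc (suc (suc (suc zero)))) = true
T5arc (suc (suc (suc zero))) (suc (suc (suc (suc zero)))) = true
T5arc (suc (suc (suc zero))) zero = true
T5arc (suc (suc (suc (suc zero)))) zero = true
T5arc (suc (suc (suc (suc zero)))) (suc zero) = true
T5arc _ _ = false

IsoT5 : Digraph → Set
IsoT5 D = Σ (Fin (n D) ⤖ Fin 5) λ f →
  ∀ x y → arc D x y ≡ T5arc (Bijection.to f x) (Bijection.to f y)

-- p4 on vertices x,y,z,v,w = 0,1,2,3,4 with arcs y→x, y→z, v→z, v→w
p4arc : Fin 5 → Fin 5 → Bool
p4arc (suc zero) zero = true
p4arc (suc zero) (suc (suc zero)) = true
p4arc (suc (suc (suc zero))) (suc (suc zero)) = true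
p4arc (suc (suc (suc zero))) (suc (suc (suc (suc zero)))) = true
p4arc _ _ = false

HasP4 : Digraph → Set
HasP4 D = Σ (Fin 5 → Fin (n D)) λ f → Injective _≡_ _≡_ f ×
  (∀ i j → p4arc i j ≡ true → arc D (f i) (f j) ≡ true)

HasK5 : Digraph → Set
HasK5 D = Σ (Fin 5 → Fin (n D)) λ f → Injective _≡_ _≡_ f ×
  (∀ i j → i ≢ j → Adj (arc D) (f i) (f j))

record Subdigraph (D : Digraph) : Set where
  field
    S   : Fin (n D) → Bool
    B   : Fin (n D) → Fin (n D) → Bool
    sub : ∀ x y → B x y ≡ true → (arc D x y ≡ true) × (S x ≡ true) × (S y ≡ true)

open Subdigraph public

remove : {m : ℕ} → (Fin m → Bool) → Fin m → Fin m → Bool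
remove S u x with Data.Fin._≟_ x u
... | Relation.Nullary.yes _ = false
... | Relation.Nullary.no _  = S x
  where open import Data.Fin

FiveCritical : {D : Digraph} → Subdigraph D → Set
FiveCritical D' = ChiEq (S D') (B D') 5 ×
  (∀ u → S D' u ≡ true → Colourable (remove (S D') u) (B D') 4)

-- A vertex of the 5-critical D′ has at least four neighbours in D′: otherwise a 4-colouring of
-- D′ − u extends to D′. Forbidding p₄ gives two local rules. If s → p → q and s → q, every further
-- out-neighbour of s is the out-neighbour x ≠ q of p, so the out-neighbourhood of s is {p, q, x}.
-- If s has three out-neighbours and y ≠ s is an in-neighbour of one of them lying outside them,
-- then y → s.
-- Call s an independent fan if it has at least three out-neighbours in D′ and no arc joins two of
-- its out-neighbours. Then at least two of these have s as their only in-neighbour, and they are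
-- independent fans again, because a triangle source with three out-neighbours in D′ must be the
-- middle of a triangle. Picking one such child is injective on the finitely many independent fans,
-- so it permutes them, and every child of s is the picked one: a contradiction. Hence v is the
-- source of a triangle v → p → q and its out-neighbourhood is {p, q, x}; finally p → q and p → x
-- lie in D′, since otherwise q (or x) would have v as its only in-neighbour in D′ while being
-- neither a triangle source nor an independent fan.

module Submission where

open import Defs
open import Data.Nat using (ℕ; zero; suc; _≤_; _<_; s≤s; _≤?_)
open import Data.Nat.Properties using (n<1+n; ≰⇒>; ≤-refl)
open import Data.Nat.GeneralisedArithmetic using (fold)
open import Data.Fin using (Fin; zero; suc; _≟_; toℕ)
open import Data.Fin.Properties using (¬∀⟶∃¬; pigeonhole; <⇒≢; any?; all?)
open import Data.Bool using (Bool; true; false; T)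
open import Data.Bool.Properties using (T-≡) renaming (_≟_ to _≟ᵇ_)
open import Data.List using (List; []; _∷_; length; lookup; map; filterᵇ; allFin)
open import Data.List.Properties using (length-map)
open import Data.List.Relation.Unary.All as All using (All; []; _∷_)
open import Data.List.Relation.Unary.All.Properties using (all-filter)
open import Data.List.Relation.Unary.AllPairs using ([]; _∷_)
open import Data.List.Relation.Unary.Any as Any using (index; here; there)
open import Data.List.Relation.Unary.Any.Properties using (lookup-index)
open import Data.List.Relation.Unary.Unique.Propositional using (Unique)
open import Data.List.Relation.Unary.Unique.Propositional.Properties using (filter⁺; allFin⁺)
open import Data.List.Membership.Propositional using (_∈_; _∉_)
open import Data.List.Membership.Propositional.Properties using (∈-lookup; ∈-map⁺; ∈-filter⁺; ∈-allFin)
open import Data.Vec.Functional using (updateAt)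
open import Data.Vec.Functional.Properties using (updateAt-updates; updateAt-minimal)
open import Data.Product using (Σ; ∃; ∃₂; _×_; _,_; proj₁; proj₂)
open import Data.Sum using (_⊎_; inj₁; inj₂; swap; map₂)
open import Data.Empty using (⊥; ⊥-elim)
open import Relation.Nullary using (¬_; Dec; yes; no; _×-dec_; ¬?)
open import Relation.Nullary.Decidable using (T?; _→-dec_)
open import Relation.Binary.PropositionalEquality using (_≡_; _≢_; refl; sym; trans; subst; cong; ≢-sym; module ≡-Reasoning)
open import Function using (_∘_; _$_; const; case_of_)
open import Function.Bundles using (Equivalence)

lookup-injective : ∀ {A : Set} {xs : List A} → Unique xs →
                   ∀ {i j} → lookup xs i ≡ lookup xs j → i ≡ j
lookup-injective {xs = _ ∷ _} _             {zero}  {zero}  _  = refl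
lookup-injective {xs = _ ∷ _} (x∉xs ∷ _)    {zero}  {suc j} eq = ⊥-elim (All.lookup x∉xs (∈-lookup j) eq)
lookup-injective {xs = _ ∷ _} (x∉xs ∷ _)    {suc i} {zero}  eq = ⊥-elim (All.lookup x∉xs (∈-lookup i) (sym eq))
lookup-injective {xs = _ ∷ _} (_ ∷ unique)  {suc i} {suc j} eq = cong suc (lookup-injective unique eq)

length<⇒∃∉ : ∀ {m} (xs : List (Fin m)) → length xs < m → ∃ λ x → x ∉ xs
length<⇒∃∉ {m} xs len< = ¬∀⟶∃¬ m (_∈ xs) (λ x → Any.any? (x ≟_) xs) ¬all∈
  where
  ¬all∈ : ¬ (∀ x → x ∈ xs)
  ¬all∈ all∈ with pigeonhole len< (index ∘ all∈)
  ... | i , j , i<j , same-index = <⇒≢ i<j (begin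
    i                           ≡⟨ lookup-index (all∈ i) ⟩
    lookup xs (index (all∈ i))  ≡⟨ cong (lookup xs) same-index ⟩
    lookup xs (index (all∈ j))  ≡⟨ lookup-index (all∈ j) ⟨
    j                           ∎)
    where open ≡-Reasoning

module _ {m : ℕ} (a : Fin m → Fin m → Bool) (s : Fin m) where

  outNeighbours : List (Fin m)
  outNeighbours = filterᵇ (a s) (allFin m)

  ∈-outNeighbours : ∀ {w} → s ⟶[ a ] w → w ∈ outNeighbours
  ∈-outNeighbours s→w = ∈-filter⁺ (T? ∘ a s) (∈-allFin _) (Equivalence.from T-≡ s→w)

  record OutTriple : Set where
    constructor outTriple
    field
      {a₁ a₂ a₃} : Fin m
      a₁≢a₂ : a₁ ≢ a₂
      a₁≢a₃ : a₁ ≢ a₃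
      a₂≢a₃ : a₂ ≢ a₃
      s→a₁  : s ⟶[ a ] a₁
      s→a₂  : s ⟶[ a ] a₂
      s→a₃  : s ⟶[ a ] a₃

  private
    outNeighbours-unique : Unique outNeighbours
    outNeighbours-unique = filter⁺ (T? ∘ a s) (allFin⁺ m)

    outNeighbours-arcs : All (λ w → T (a s w)) outNeighbours
    outNeighbours-arcs = all-filter (T? ∘ a s) (allFin m)

    T⇒arc : ∀ {w} → T (a s w) → s ⟶[ a ] w
    T⇒arc = Equivalence.to T-≡

  outdeg≥2⇒∃out≢ : 2 ≤ outdeg a s → ∀ z → ∃ λ t → t ≢ z × s ⟶[ a ] t
  outdeg≥2⇒∃out≢ = pick outNeighbours-unique outNeighbours-arcs
    where
    pick : ∀ {xs} → Unique xs → All (λ w → T (a s w)) xs → 2 ≤ length xs →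
           ∀ z → ∃ λ t → t ≢ z × s ⟶[ a ] t
    pick {x ∷ y ∷ _} ((x≢y ∷ _) ∷ _) (sx ∷ sy ∷ _) (s≤s (s≤s _)) z with x ≟ z
    ... | yes refl = y , ≢-sym x≢y , T⇒arc sy
    ... | no x≢z   = x , x≢z , T⇒arc sx

  outdeg≥3⇒OutTriple : 3 ≤ outdeg a s → OutTriple
  outdeg≥3⇒OutTriple = pick outNeighbours-unique outNeighbours-arcs
    where
    pick : ∀ {xs} → Unique xs → All (λ w → T (a s w)) xs → 3 ≤ length xs → OutTriple
    pick {_ ∷ _ ∷ _ ∷ _} ((x≢y ∷ x≢z ∷ _) ∷ (y≢z ∷ _) ∷ _) (sx ∷ sy ∷ sz ∷ _) (s≤s (s≤s (s≤s _))) =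
      outTriple x≢y x≢z y≢z (T⇒arc sx) (T⇒arc sy) (T⇒arc sz)

remove-keeps : ∀ {m} {S : Fin m → Bool} {u x} → S x ≡ true → x ≢ u → remove S u x ≡ true
remove-keeps {u = u} {x} Sx x≢u with x ≟ u
... | yes x≡u = ⊥-elim (x≢u x≡u)
... | no _    = Sx

critical-neighbourhood-⊈-short : ∀ {m k} {S : Fin m → Bool} {a : Fin m → Fin m → Bool} →
  (∀ x → ¬ x ⟶[ a ] x) → ∀ {u} → S u ≡ true →
  Colourable (remove S u) a k → ¬ Colourable S a k →
  ∀ ns → length ns < k → ¬ (∀ w → Adj a u w → w ∈ ns)
critical-neighbourhood-⊈-short {m} {k} {S} {a} irrefl {u} Su (c , proper) ¬colourable ns len< ⊆ns =
  ¬colourable (c′ , proper′)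
  where
  free : ∃ λ colour → colour ∉ map c ns
  free = length<⇒∃∉ (map c ns) (subst (_< k) (sym (length-map c ns)) len<)

  c′ : Fin m → Fin k
  c′ = updateAt c u (const (proj₁ free))

  c′-fresh : ∀ w → Adj a u w → c′ u ≢ c w
  c′-fresh w adj eq =
    proj₂ free (subst (_∈ map c ns) (trans (sym eq) (updateAt-updates u c)) (∈-map⁺ c (⊆ns w adj)))

  c′-keeps : ∀ {x} → x ≢ u → c′ x ≡ c x
  c′-keeps {x} x≢u = updateAt-minimal x u c x≢u

  no-loop : ¬ Adj a u u
  no-loop (inj₁ u→u) = irrefl u u→u
  no-loop (inj₂ u→u) = irrefl u u→u

  proper′ : ProperColouring S a k c′
  proper′ x y Sx Sy adj with x ≟ u | y ≟ u
  ... | yes refl | yes refl = ⊥-elim (no-loop adj)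
  ... | yes refl | no y≢u   = λ eq → c′-fresh y adj (trans eq (c′-keeps y≢u))
  ... | no x≢u   | yes refl = λ eq → c′-fresh x (swap adj) (trans (sym eq) (c′-keeps x≢u))
  ... | no x≢u   | no y≢u   = λ eq → proper x y (remove-keeps Sx x≢u) (remove-keeps Sy y≢u) adj
                                      (trans (sym (c′-keeps x≢u)) (trans eq (c′-keeps y≢u)))

injective-on-invariant⇒surjective : ∀ {m} (f : Fin m → Fin m) (P : Fin m → Set) →
  (∀ {x} → P x → P (f x)) → (∀ {x y} → P x → P y → f x ≡ f y → x ≡ y) →
  ∀ {x} → P x → ∃ λ y → P y × f y ≡ x
injective-on-invariant⇒surjective {m} f P preserved injective {x} Px
  with pigeonhole (n<1+n m) (λ (i : Fin (suc m)) → fold x f (toℕ i))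
... | i , j , i<j , eq = go (toℕ i) (toℕ j) i<j eq
  where
  P-orbit : ∀ k → P (fold x f k)
  P-orbit zero    = Px
  P-orbit (suc k) = preserved (P-orbit k)

  go : ∀ i j → i < j → fold x f i ≡ fold x f j → ∃ λ y → P y × f y ≡ x
  go zero    (suc k) _         eq = fold x f k , P-orbit k , sym eq
  go (suc i) (suc j) (s≤s i<j) eq = go i j i<j (injective (P-orbit i) (P-orbit j) eq)

pattern ≡₁ = inj₁ refl
pattern ≡₂ = inj₂ (inj₁ refl)
pattern ≡₃ = inj₂ (inj₂ refl)

cover₃ : ∀ {A : Set} {P : A → Set} {p q x a₁ a₂ a₃ : A} → a₁ ≢ a₂ → a₁ ≢ a₃ → a₂ ≢ a₃ →
         a₁ ≡ p ⊎ a₁ ≡ q ⊎ a₁ ≡ x → a₂ ≡ p ⊎ a₂ ≡ q ⊎ a₂ ≡ x → a₃ ≡ p ⊎ a₃ ≡ q ⊎ a₃ ≡ x →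
         P a₁ → P a₂ → P a₃ → P p × P q × P x
cover₃ a₁≢a₂ _ _ ≡₁ ≡₁ _ _ _ _ = ⊥-elim (a₁≢a₂ refl)
cover₃ a₁≢a₂ _ _ ≡₂ ≡₂ _ _ _ _ = ⊥-elim (a₁≢a₂ refl)
cover₃ a₁≢a₂ _ _ ≡₃ ≡₃ _ _ _ _ = ⊥-elim (a₁≢a₂ refl)
cover₃ _ a₁≢a₃ _ ≡₁ ≡₂ ≡₁ _ _ _ = ⊥-elim (a₁≢a₃ refl)
cover₃ _ _ a₂≢a₃ ≡₁ ≡₂ ≡₂ _ _ _ = ⊥-elim (a₂≢a₃ refl)
cover₃ _ _ _     ≡₁ ≡₂ ≡₃ P₁ P₂ P₃ = P₁ , P₂ , P₃
cover₃ _ a₁≢a₃ _ ≡₁ ≡₃ ≡₁ _ _ _ = ⊥-elim (a₁≢a₃ refl)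
cover₃ _ _ _     ≡₁ ≡₃ ≡₂ P₁ P₂ P₃ = P₁ , P₃ , P₂
cover₃ _ _ a₂≢a₃ ≡₁ ≡₃ ≡₃ _ _ _ = ⊥-elim (a₂≢a₃ refl)
cover₃ _ _ a₂≢a₃ ≡₂ ≡₁ ≡₁ _ _ _ = ⊥-elim (a₂≢a₃ refl)
cover₃ _ a₁≢a₃ _ ≡₂ ≡₁ ≡₂ _ _ _ = ⊥-elim (a₁≢a₃ refl)
cover₃ _ _ _     ≡₂ ≡₁ ≡₃ P₁ P₂ P₃ = P₂ , P₁ , P₃
cover₃ _ _ _     ≡₂ ≡₃ ≡₁ P₁ P₂ P₃ = P₃ , P₁ , P₂
cover₃ _ a₁≢a₃ _ ≡₂ ≡₃ ≡₂ _ _ _ = ⊥-elim (a₁≢a₃ refl)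
cover₃ _ _ a₂≢a₃ ≡₂ ≡₃ ≡₃ _ _ _ = ⊥-elim (a₂≢a₃ refl)
cover₃ _ _ a₂≢a₃ ≡₃ ≡₁ ≡₁ _ _ _ = ⊥-elim (a₂≢a₃ refl)
cover₃ _ _ _     ≡₃ ≡₁ ≡₂ P₁ P₂ P₃ = P₂ , P₃ , P₁
cover₃ _ a₁≢a₃ _ ≡₃ ≡₁ ≡₃ _ _ _ = ⊥-elim (a₁≢a₃ refl)
cover₃ _ _ _     ≡₃ ≡₂ ≡₁ P₁ P₂ P₃ = P₃ , P₂ , P₁
cover₃ _ _ a₂≢a₃ ≡₃ ≡₂ ≡₂ _ _ _ = ⊥-elim (a₂≢a₃ refl)
cover₃ _ a₁≢a₃ _ ≡₃ ≡₂ ≡₃ _ _ _ = ⊥-elim (a₁≢a₃ refl)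

true≢false : true ≢ false
true≢false ()

module P4Free (D : Digraph) (p4-free : ¬ HasP4 D) (outdeg≥2 : ∀ x → 2 ≤ outdeg (arc D) x) where

  V : Set
  V = Fin (n D)

  infix 4 _↦_
  _↦_ : V → V → Set
  x ↦ y = x ⟶[ arc D ] y

  ↦-irrefl : ∀ {x y} → x ↦ y → x ≢ y
  ↦-irrefl x↦x refl = true≢false (trans (sym x↦x) (loopless D _))

  ↦-irrefl′ : ∀ {x y} → x ↦ y → y ≢ x
  ↦-irrefl′ x↦y = ≢-sym (↦-irrefl x↦y)

  ↦-asym : ∀ {x y} → x ↦ y → ¬ y ↦ x
  ↦-asym x↦y y↦x = true≢false (trans (sym y↦x) (asym D _ _ x↦y))

  ∃out≢ : ∀ x z → ∃ λ t → t ≢ z × x ↦ t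
  ∃out≢ x = outdeg≥2⇒∃out≢ (arc D) x (outdeg≥2 x)

  no-p4 : ∀ {x y z v w} → Unique (x ∷ y ∷ z ∷ v ∷ w ∷ []) → y ↦ x → y ↦ z → v ↦ z → v ↦ w → ⊥
  no-p4 {x} {y} {z} {v} {w} distinct y↦x y↦z v↦z v↦w =
    p4-free (lookup vertices , lookup-injective distinct , arcs)
    where
    vertices : List V
    vertices = x ∷ y ∷ z ∷ v ∷ w ∷ []

    arcs : ∀ i j → p4arc i j ≡ true → lookup vertices i ↦ lookup vertices j
    arcs zero _ ()
    arcs (suc zero) zero _ = y↦x
    arcs (suc zero) (suc zero) ()
    arcs (suc zero) (suc (suc zero)) _ = y↦z
    arcs (suc zero) (suc (suc (suc _))) ()
    arcs (suc (suc zero)) _ ()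
    arcs (suc (suc (suc zero))) (suc (suc zero)) _ = v↦z
    arcs (suc (suc (suc zero))) (suc (suc (suc (suc zero)))) _ = v↦w
    arcs (suc (suc (suc zero))) zero ()
    arcs (suc (suc (suc zero))) (suc zero) ()
    arcs (suc (suc (suc zero))) (suc (suc (suc zero))) ()
    arcs (suc (suc (suc (suc zero)))) _ ()

  -- Otherwise t ← p → q ← s → w is a copy of p₄.
  out-of-source≡out-of-middle : ∀ {s p q t w} → s ↦ p → s ↦ q → p ↦ q → p ↦ t → t ≢ q →
                                s ↦ w → w ≢ p → w ≢ q → w ≡ t
  out-of-source≡out-of-middle {s} {p} {q} {t} {w} s↦p s↦q p↦q p↦t t≢q s↦w w≢p w≢q with w ≟ t
  ... | yes w≡t = w≡t
  ... | no w≢t  = ⊥-elim (no-p4 distinct p↦t p↦q s↦q s↦w)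
    where
    t≢s : t ≢ s
    t≢s refl = ↦-asym s↦p p↦t

    distinct : Unique (t ∷ p ∷ q ∷ s ∷ w ∷ [])
    distinct = (↦-irrefl′ p↦t ∷ t≢q ∷ t≢s ∷ ≢-sym w≢t ∷ [])
             ∷ (↦-irrefl p↦q ∷ ↦-irrefl′ s↦p ∷ ≢-sym w≢p ∷ [])
             ∷ (↦-irrefl′ s↦q ∷ ≢-sym w≢q ∷ [])
             ∷ (↦-irrefl s↦w ∷ [])
             ∷ [] ∷ []

  no-arc-between-sinks : ∀ {v p q x} → v ↦ p → v ↦ q → v ↦ x → p ↦ q → p ↦ x → ¬ q ↦ x
  no-arc-between-sinks {v} {p} {q} {x} v↦p v↦q v↦x p↦q p↦x q↦x with ∃out≢ q x
  ... | t , t≢x , q↦t = ↦-asym p↦q (subst (q ↦_) (sym p≡t) q↦t)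
    where
    p≡t : p ≡ t
    p≡t = out-of-source≡out-of-middle v↦q v↦x q↦x q↦t t≢x v↦p (↦-irrefl p↦q) (↦-irrefl p↦x)

  -- Otherwise t ← y → a ← s → w is a copy of p₄ for w = b or w = c.
  other-in-neighbour-outs : ∀ {s a b c y t} → s ↦ a → s ↦ b → s ↦ c → a ≢ b → a ≢ c → b ≢ c →
               y ↦ a → y ≢ s → y ≢ b → y ≢ c → y ↦ t → t ≢ a → t ≡ s
  other-in-neighbour-outs {s} {a} {b} {c} {y} {t} s↦a s↦b s↦c a≢b a≢c b≢c y↦a y≢s y≢b y≢c y↦t t≢a
    with t ≟ s
  ... | yes t≡s = t≡s
  ... | no t≢s  = ⊥-elim (escape (t ≟ b))
    where
    p4-via : ∀ {w} → s ↦ w → a ≢ w → y ≢ w → t ≢ w → ⊥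
    p4-via {w} s↦w a≢w y≢w t≢w = no-p4 distinct y↦t y↦a s↦a s↦w
      where
      distinct : Unique (t ∷ y ∷ a ∷ s ∷ w ∷ [])
      distinct = (↦-irrefl′ y↦t ∷ t≢a ∷ t≢s ∷ t≢w ∷ [])
               ∷ (↦-irrefl y↦a ∷ y≢s ∷ y≢w ∷ [])
               ∷ (↦-irrefl′ s↦a ∷ a≢w ∷ [])
               ∷ (↦-irrefl s↦w ∷ [])
               ∷ [] ∷ []

    escape : Dec (t ≡ b) → ⊥
    escape (yes refl) = p4-via s↦c a≢c y≢c b≢c
    escape (no t≢b)   = p4-via s↦b a≢b y≢b t≢b

  other-in-neighbour↦source : ∀ {s a b c y} → s ↦ a → s ↦ b → s ↦ c → a ≢ b → a ≢ c → b ≢ c →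
                 y ↦ a → y ≢ s → y ≢ b → y ≢ c → y ↦ s
  other-in-neighbour↦source s↦a s↦b s↦c a≢b a≢c b≢c y↦a y≢s y≢b y≢c with ∃out≢ _ _
  ... | t , t≢a , y↦t =
    subst (_ ↦_) (other-in-neighbour-outs s↦a s↦b s↦c a≢b a≢c b≢c y↦a y≢s y≢b y≢c y↦t t≢a) y↦t

  TriangleSource : V → Set
  TriangleSource s = ∃₂ λ p q → s ↦ p × s ↦ q × p ↦ q

  TriangleMiddle : V → Set
  TriangleMiddle s = ∃₂ λ y z → y ↦ s × s ↦ z × y ↦ z

  TriangleSource? : ∀ s → Dec (TriangleSource s)
  TriangleSource? s = any? λ p → any? λ q →
    (arc D s p ≟ᵇ true) ×-dec (arc D s q ≟ᵇ true) ×-dec (arc D p q ≟ᵇ true)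

  module Critical (D′ : Subdigraph D) (critical : FiveCritical D′) where

    infix 4 _⇒_
    _⇒_ : V → V → Set
    x ⇒ y = x ⟶[ B D′ ] y

    ⇒⊆↦ : ∀ {x y} → x ⇒ y → x ↦ y
    ⇒⊆↦ {x} {y} x⇒y = proj₁ (sub D′ x y x⇒y)

    ⇒-target∈D′ : ∀ {x y} → x ⇒ y → S D′ y ≡ true
    ⇒-target∈D′ {x} {y} x⇒y = proj₂ (proj₂ (sub D′ x y x⇒y))

    neighbourhood-⊈-short : ∀ {u} → S D′ u ≡ true → ∀ ns → length ns < 4 →
                            ¬ (∀ w → Adj (B D′) u w → w ∈ ns)
    neighbourhood-⊈-short {u} Su = critical-neighbourhood-⊈-short
      (λ x x⇒x → ↦-irrefl (⇒⊆↦ x⇒x) refl) Su (proj₂ critical u Su) (proj₂ (proj₁ critical))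

    sole-in-neighbour⇒outdeg≥3 : ∀ {s a} → S D′ a ≡ true → (∀ y → y ⇒ a → y ≡ s) →
                                  3 ≤ outdeg (B D′) a
    sole-in-neighbour⇒outdeg≥3 {s} {a} Sa sole with 3 ≤? outdeg (B D′) a
    ... | yes outdeg≥3 = outdeg≥3
    ... | no  outdeg≱3 = ⊥-elim (neighbourhood-⊈-short Sa (s ∷ outNeighbours (B D′) a)
                                   (s≤s (≰⇒> outdeg≱3)) neighbours⊆)
      where
      neighbours⊆ : ∀ w → Adj (B D′) a w → w ∈ s ∷ outNeighbours (B D′) a
      neighbours⊆ w (inj₁ a⇒w) = there (∈-outNeighbours (B D′) a a⇒w)
      neighbours⊆ w (inj₂ w⇒a) = here (sole w w⇒a)

    record TransitiveFan (s p q : V) : Set where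
      field
        x      : V
        x≢q    : x ≢ q
        p↦x    : p ↦ x
        s⇒p    : s ⇒ p
        s⇒q    : s ⇒ q
        s⇒x    : s ⇒ x
        s-outs : ∀ w → s ↦ w → w ≡ p ⊎ w ≡ q ⊎ w ≡ x
        p-outs : ∀ t → p ↦ t → t ≡ q ⊎ t ≡ x

    transitiveFan : ∀ {s p q} → 3 ≤ outdeg (B D′) s → s ↦ p → s ↦ q → p ↦ q → TransitiveFan s p q
    transitiveFan {s} {p} {q} outdeg≥3 s↦p s↦q p↦q with ∃out≢ p q
    ... | x , x≢q , p↦x = record
      { x = x ; x≢q = x≢q ; p↦x = p↦x
      ; s⇒p = proj₁ covered ; s⇒q = proj₁ (proj₂ covered) ; s⇒x = s⇒x
      ; s-outs = s-outs ; p-outs = p-outs }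
      where
      open OutTriple (outdeg≥3⇒OutTriple (B D′) s outdeg≥3)

      s-outs : ∀ w → s ↦ w → w ≡ p ⊎ w ≡ q ⊎ w ≡ x
      s-outs w s↦w with w ≟ p | w ≟ q
      ... | yes w≡p | _       = inj₁ w≡p
      ... | no _    | yes w≡q = inj₂ (inj₁ w≡q)
      ... | no w≢p  | no w≢q  =
        inj₂ (inj₂ (out-of-source≡out-of-middle s↦p s↦q p↦q p↦x x≢q s↦w w≢p w≢q))

      covered : s ⇒ p × s ⇒ q × s ⇒ x
      covered = cover₃ a₁≢a₂ a₁≢a₃ a₂≢a₃
        (s-outs _ (⇒⊆↦ s→a₁)) (s-outs _ (⇒⊆↦ s→a₂)) (s-outs _ (⇒⊆↦ s→a₃)) s→a₁ s→a₂ s→a₃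

      s⇒x : s ⇒ x
      s⇒x = proj₂ (proj₂ covered)

      p-outs : ∀ t → p ↦ t → t ≡ q ⊎ t ≡ x
      p-outs t p↦t with t ≟ q
      ... | yes t≡q = inj₁ t≡q
      ... | no t≢q  = inj₂ (sym (out-of-source≡out-of-middle s↦p s↦q p↦q p↦t t≢q
                                   (⇒⊆↦ s⇒x) (↦-irrefl′ p↦x) x≢q))

    -- p would have at most the three neighbours s, q, x in D′.
    source⇒¬¬middle : ∀ {s} → 3 ≤ outdeg (B D′) s → TriangleSource s → ¬ ¬ TriangleMiddle s
    source⇒¬¬middle {s} outdeg≥3 (p , q , s↦p , s↦q , p↦q) ¬middle =
      neighbourhood-⊈-short (⇒-target∈D′ s⇒p) (s ∷ q ∷ x ∷ []) ≤-refl neighbours⊆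
      where
      open TransitiveFan (transitiveFan outdeg≥3 s↦p s↦q p↦q)

      sole-in-neighbour : ∀ y → y ↦ p → y ≡ s
      sole-in-neighbour y y↦p with y ≟ s
      ... | yes y≡s = y≡s
      ... | no y≢s  = ⊥-elim (¬middle (y , p , y↦s , s↦p , y↦p))
        where
        y↦s : y ↦ s
        y↦s = other-in-neighbour↦source s↦p s↦q (⇒⊆↦ s⇒x) (↦-irrefl p↦q) (↦-irrefl p↦x) (≢-sym x≢q)
                y↦p y≢s (λ { refl → ↦-asym p↦q y↦p }) (λ { refl → ↦-asym p↦x y↦p })

      neighbours⊆ : ∀ w → Adj (B D′) p w → w ∈ s ∷ q ∷ x ∷ []
      neighbours⊆ w (inj₁ p⇒w) with p-outs w (⇒⊆↦ p⇒w)
      ... | inj₁ refl = there (here refl)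
      ... | inj₂ refl = there (there (here refl))
      neighbours⊆ w (inj₂ w⇒p) = here (sole-in-neighbour w (⇒⊆↦ w⇒p))

    IndependentFan : V → Set
    IndependentFan s = S D′ s ≡ true × 3 ≤ outdeg (B D′) s × ¬ TriangleSource s

    SoleInNeighbour : V → V → Set
    SoleInNeighbour s a = ∀ y → y ↦ a → y ≡ s

    Child : V → V → Set
    Child s a = s ↦ a × SoleInNeighbour s a × IndependentFan a

    ¬source⇒child : ∀ {s a} → ¬ TriangleSource s → s ⇒ a → SoleInNeighbour s a → Child s a
    ¬source⇒child {s} {a} ¬source s⇒a sole =
      ⇒⊆↦ s⇒a , sole , Sa , outdeg≥3 , λ source → source⇒¬¬middle outdeg≥3 source ¬middle
      where
      Sa : S D′ a ≡ true
      Sa = ⇒-target∈D′ s⇒a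

      outdeg≥3 : 3 ≤ outdeg (B D′) a
      outdeg≥3 = sole-in-neighbour⇒outdeg≥3 Sa (λ y y⇒a → sole y (⇒⊆↦ y⇒a))

      ¬middle : ¬ TriangleMiddle a
      ¬middle (y , z , y↦a , a↦z , y↦z) with sole y y↦a
      ... | refl = ¬source (a , z , ⇒⊆↦ s⇒a , y↦z , a↦z)

    OtherInNeighbour : V → V → Set
    OtherInNeighbour s a = ∃ λ y → y ↦ a × y ≢ s

    OtherInNeighbour? : ∀ s a → Dec (OtherInNeighbour s a)
    OtherInNeighbour? s a = any? λ y → (arc D y a ≟ᵇ true) ×-dec ¬? (y ≟ s)

    ¬other⇒sole : ∀ {s a} → ¬ OtherInNeighbour s a → SoleInNeighbour s a
    ¬other⇒sole {s} ¬other y y↦a with y ≟ s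
    ... | yes y≡s = y≡s
    ... | no y≢s  = ⊥-elim (¬other (y , y↦a , y≢s))

    -- Both y and y′ point to s, so a ← y → s ← y′ → b is a copy of p₄.
    other-in-neighbours-clash : ∀ {s a b c} → ¬ TriangleSource s → s ↦ a → s ↦ b → s ↦ c →
                                a ≢ b → a ≢ c → b ≢ c →
                                OtherInNeighbour s a → OtherInNeighbour s b → ⊥
    other-in-neighbours-clash {s} {a} {b} {c} ¬source s↦a s↦b s↦c a≢b a≢c b≢c
                              (y , y↦a , y≢s) (y′ , y′↦b , y′≢s) =
      no-p4 distinct y↦a y↦s y′↦s y′↦b
      where
      ¬↦between : ∀ {u w} → s ↦ u → s ↦ w → ¬ u ↦ w
      ¬↦between s↦u s↦w u↦w = ¬source (_ , _ , s↦u , s↦w , u↦w)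

      y≢b : y ≢ b
      y≢b refl = ¬↦between s↦b s↦a y↦a
      y≢c : y ≢ c
      y≢c refl = ¬↦between s↦c s↦a y↦a
      y′≢a : y′ ≢ a
      y′≢a refl = ¬↦between s↦a s↦b y′↦b
      y′≢c : y′ ≢ c
      y′≢c refl = ¬↦between s↦c s↦b y′↦b

      y↦s : y ↦ s
      y↦s = other-in-neighbour↦source s↦a s↦b s↦c a≢b a≢c b≢c y↦a y≢s y≢b y≢c
      y′↦s : y′ ↦ s
      y′↦s = other-in-neighbour↦source s↦b s↦a s↦c (≢-sym a≢b) b≢c a≢c y′↦b y′≢s y′≢a y′≢c

      y≢y′ : y ≢ y′
      y≢y′ refl = ↦-irrefl′ s↦b
        (other-in-neighbour-outs s↦a s↦b s↦c a≢b a≢c b≢c y↦a y≢s y≢b y≢c y′↦b (≢-sym a≢b))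

      distinct : Unique (a ∷ y ∷ s ∷ y′ ∷ b ∷ [])
      distinct = (↦-irrefl′ y↦a ∷ ↦-irrefl′ s↦a ∷ ≢-sym y′≢a ∷ a≢b ∷ [])
               ∷ (y≢s ∷ y≢y′ ∷ y≢b ∷ [])
               ∷ (≢-sym y′≢s ∷ ↦-irrefl s↦b ∷ [])
               ∷ (↦-irrefl y′↦b ∷ [])
               ∷ [] ∷ []

    two-children : ∀ {s} → IndependentFan s → ∃₂ λ a b → a ≢ b × Child s a × Child s b
    two-children {s} (_ , outdeg≥3 , ¬source) = choose (outdeg≥3⇒OutTriple (B D′) s outdeg≥3)
      where
      child : ∀ {a} → s ⇒ a → ¬ OtherInNeighbour s a → Child s a
      child s⇒a ¬other = ¬source⇒child ¬source s⇒a (¬other⇒sole ¬other)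

      clash : ∀ {a b c} → s ⇒ a → s ⇒ b → s ⇒ c → a ≢ b → a ≢ c → b ≢ c →
              OtherInNeighbour s a → OtherInNeighbour s b → ⊥
      clash s⇒a s⇒b s⇒c = other-in-neighbours-clash ¬source (⇒⊆↦ s⇒a) (⇒⊆↦ s⇒b) (⇒⊆↦ s⇒c)

      choose : OutTriple (B D′) s → ∃₂ λ a b → a ≢ b × Child s a × Child s b
      choose (outTriple {a₁} {a₂} {a₃} a₁≢a₂ a₁≢a₃ a₂≢a₃ s⇒a₁ s⇒a₂ s⇒a₃)
        with OtherInNeighbour? s a₁ | OtherInNeighbour? s a₂ | OtherInNeighbour? s a₃
      ... | no ¬o₁ | no ¬o₂ | _      = a₁ , a₂ , a₁≢a₂ , child s⇒a₁ ¬o₁ , child s⇒a₂ ¬o₂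
      ... | no ¬o₁ | yes _  | no ¬o₃ = a₁ , a₃ , a₁≢a₃ , child s⇒a₁ ¬o₁ , child s⇒a₃ ¬o₃
      ... | yes _  | no ¬o₂ | no ¬o₃ = a₂ , a₃ , a₂≢a₃ , child s⇒a₂ ¬o₂ , child s⇒a₃ ¬o₃
      ... | yes o₁ | yes o₂ | _      = ⊥-elim (clash s⇒a₁ s⇒a₂ s⇒a₃ a₁≢a₂ a₁≢a₃ a₂≢a₃ o₁ o₂)
      ... | yes o₁ | no _   | yes o₃ = ⊥-elim (clash s⇒a₁ s⇒a₃ s⇒a₂ a₁≢a₃ a₁≢a₂ (≢-sym a₂≢a₃) o₁ o₃)
      ... | no _   | yes o₂ | yes o₃ = ⊥-elim (clash s⇒a₂ s⇒a₃ s⇒a₁ a₂≢a₃ (≢-sym a₁≢a₂) (≢-sym a₁≢a₃) o₂ o₃)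

    IndependentFan? : ∀ s → Dec (IndependentFan s)
    IndependentFan? s = (S D′ s ≟ᵇ true) ×-dec (3 ≤? outdeg (B D′) s) ×-dec ¬? (TriangleSource? s)

    Child? : ∀ s a → Dec (Child s a)
    Child? s a = (arc D s a ≟ᵇ true) ×-dec all? (λ y → (arc D y a ≟ᵇ true) →-dec (y ≟ s))
                 ×-dec IndependentFan? a

    next : V → V
    next s with any? (Child? s)
    ... | yes (a , _) = a
    ... | no _        = s

    next-child : ∀ {s} → IndependentFan s → Child s (next s)
    next-child {s} fan with any? (Child? s)
    ... | yes (_ , child) = child
    ... | no ¬child with two-children fan
    ...   | a , _ , _ , child , _ = ⊥-elim (¬child (a , child))

    next-injective : ∀ {x y} → IndependentFan x → IndependentFan y → next x ≡ next y → x ≡ y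
    next-injective {x} {y} fan-x fan-y next-x≡next-y = sym $
      proj₁ (proj₂ (next-child fan-x)) y
        (subst (y ↦_) (sym next-x≡next-y) (proj₁ (next-child fan-y)))

    -- next is injective on the finitely many independent fans, so c = next u for an independent
    -- fan u; then u ↦ c forces u = v.
    child≡next : ∀ {v c} → Child v c → next v ≡ c
    child≡next {v} {c} (_ , sole , fan-c)
      with injective-on-invariant⇒surjective next IndependentFan
             (proj₂ ∘ proj₂ ∘ next-child) next-injective fan-c
    ... | u , fan-u , next-u≡c with sole u (subst (u ↦_) next-u≡c (proj₁ (next-child fan-u)))
    ...   | refl = next-u≡c

    ¬IndependentFan : ∀ {v} → ¬ IndependentFan v
    ¬IndependentFan fan with two-children fan
    ... | _ , _ , a≢b , child-a , child-b =
      a≢b (trans (sym (child≡next child-a)) (child≡next child-b))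

    ¬¬middle-of-sole-in-neighbour : ∀ {s a} → S D′ a ≡ true → (∀ y → y ⇒ a → y ≡ s) →
                                     ¬ ¬ TriangleMiddle a
    ¬¬middle-of-sole-in-neighbour {s} {a} Sa sole ¬middle with TriangleSource? a
    ... | yes source = source⇒¬¬middle (sole-in-neighbour⇒outdeg≥3 Sa sole) source ¬middle
    ... | no ¬source = ¬IndependentFan (Sa , sole-in-neighbour⇒outdeg≥3 Sa sole , ¬source)

    -- Were p ⇏ q, then q would have v as its only in-neighbour in D′ without being the middle
    -- of a triangle.
    fan-middle-arc∈D′ : ∀ {v p q x} → v ↦ p → v ↦ q → v ↦ x → p ↦ q → p ↦ x → q ≢ x →
                        (∀ w → v ↦ w → w ≡ p ⊎ w ≡ q ⊎ w ≡ x) → (∀ t → p ↦ t → t ≡ q ⊎ t ≡ x) →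
                        v ⇒ q → p ⇒ q
    fan-middle-arc∈D′ {v} {p} {q} {x} v↦p v↦q v↦x p↦q p↦x q≢x v-outs p-outs v⇒q
      with B D′ p q in p⇒?q
    ... | true  = refl
    ... | false = ⊥-elim (¬¬middle-of-sole-in-neighbour (⇒-target∈D′ v⇒q) sole-in-neighbour ¬middle)
      where
      in-neighbours : ∀ y → y ↦ q → y ≡ v ⊎ y ≡ p
      in-neighbours y y↦q with y ≟ v | y ≟ p
      ... | yes y≡v | _       = inj₁ y≡v
      ... | no _    | yes y≡p = inj₂ y≡p
      ... | no y≢v  | no y≢p  = ⊥-elim (no-p4 distinct y↦v y↦q p↦q p↦x)
        where
        y≢x : y ≢ x
        y≢x refl = no-arc-between-sinks v↦p v↦x v↦q p↦x p↦q y↦q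

        y↦v : y ↦ v
        y↦v = other-in-neighbour↦source v↦q v↦p v↦x (↦-irrefl′ p↦q) q≢x (↦-irrefl p↦x)
                y↦q y≢v y≢p y≢x

        distinct : Unique (v ∷ y ∷ q ∷ p ∷ x ∷ [])
        distinct = (≢-sym y≢v ∷ ↦-irrefl v↦q ∷ ↦-irrefl v↦p ∷ ↦-irrefl v↦x ∷ [])
                 ∷ (↦-irrefl y↦q ∷ y≢p ∷ y≢x ∷ [])
                 ∷ (↦-irrefl′ p↦q ∷ q≢x ∷ [])
                 ∷ (↦-irrefl p↦x ∷ [])
                 ∷ [] ∷ []

      sole-in-neighbour : ∀ y → y ⇒ q → y ≡ v
      sole-in-neighbour y y⇒q with in-neighbours y (⇒⊆↦ y⇒q)
      ... | inj₁ y≡v  = y≡v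
      ... | inj₂ refl = ⊥-elim (true≢false (trans (sym y⇒q) p⇒?q))

      ¬out-of-q : ∀ {z} → q ↦ z → ¬ (z ≡ p ⊎ z ≡ q ⊎ z ≡ x)
      ¬out-of-q q↦z ≡₁ = ↦-asym p↦q q↦z
      ¬out-of-q q↦z ≡₂ = ↦-irrefl q↦z refl
      ¬out-of-q q↦z ≡₃ = no-arc-between-sinks v↦p v↦q v↦x p↦q p↦x q↦z

      ¬middle : ¬ TriangleMiddle q
      ¬middle (y , z , y↦q , q↦z , y↦z) with in-neighbours y y↦q
      ... | inj₁ refl = ¬out-of-q q↦z (v-outs z y↦z)
      ... | inj₂ refl = ¬out-of-q q↦z (inj₂ (p-outs z y↦z))

lemma2p13 : (D : Digraph) → Connected D → χ≡ D 5 → ¬ IsoT5 D →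
    (∀ x → 2 ≤ outdeg (arc D) x) → ¬ HasP4 D → ¬ HasK5 D →
    (D' : Subdigraph D) → FiveCritical D' →
    ∀ v → S D' v ≡ true → 3 ≤ outdeg (B D') v →
    Σ (Fin (n D)) λ v₁ → Σ (Fin (n D)) λ v₂ → Σ (Fin (n D)) λ v₃ →
      v₁ ≢ v₂ × v₁ ≢ v₃ × v₂ ≢ v₃ ×
      (∀ y → B D' v y ≡ true → (y ≡ v₁ ⊎ y ≡ v₂ ⊎ y ≡ v₃)) ×
      B D' v v₁ ≡ true × B D' v v₂ ≡ true × B D' v v₃ ≡ true ×
      B D' v₁ v₂ ≡ true × B D' v₁ v₃ ≡ true
lemma2p13 D _ _ _ outdeg≥2 p4-free _ D′ critical v Sv outdeg≥3 = case TriangleSource? v of λ where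
    (no ¬source) → ⊥-elim (¬IndependentFan (Sv , outdeg≥3 , ¬source))
    (yes (p , q , v↦p , v↦q , p↦q)) →
      let open TransitiveFan (transitiveFan outdeg≥3 v↦p v↦q p↦q)
          q≢x = ≢-sym x≢q
      in p , q , x , ↦-irrefl p↦q , ↦-irrefl p↦x , q≢x , (λ y → s-outs y ∘ ⇒⊆↦) , s⇒p , s⇒q , s⇒x ,
         fan-middle-arc∈D′ v↦p v↦q (⇒⊆↦ s⇒x) p↦q p↦x q≢x s-outs p-outs s⇒q ,
         fan-middle-arc∈D′ v↦p (⇒⊆↦ s⇒x) v↦q p↦x p↦q x≢q
           (λ w → map₂ swap ∘ s-outs w) (λ t → swap ∘ p-outs t) s⇒x
  where
  open P4Free D p4-free outdeg≥2
  open Critical D′ critical
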